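{- Let $\mathcal{P}_\nu$ be the set of partitions $\lambda=(\lambda_1>\cdots>\lambda_\ell)$ into distinct parts in $\mathbb{Z}_{\ge0}$ (a smallest part $0$ is allowed) such that every odd part $\lambda_i$ satisfies $\lambda_i<2\lambda_\ell$. For $\lambda=(\lambda_1,\dots,\lambda_\ell)\in\mathcal{P}_\nu$ define $\rho_2^+(\lambda)=(\lambda_1+2,\dots,\lambda_{\ell-1}+2,\lambda_\ell+1)$, and let $\phi_e^+(\lambda)=(\lambda_1+2,\dots,\lambda_\ell+2)$. Define $\rho_1^+(\lambda)$ by: (i) if all parts $\lambda_i$ are even: $\rho_1^+(\lambda)$ is $\phi_e^+(\lambda)$ with an extra part $0$ appended at the end; (ii) if some part $\lambda_i$ is odd: choose a largest odd part $\kappa$ of $\phi_e^+(\lambda)$ and let $\rho_1^+(\lambda)$ be the nonincreasing rearrangement of the sequence obtained from $\phi_e^+(\lambda)$ by removing $\kappa$ and adding the two parts $(\kappa+1)/2$ and $(\kappa-1)/2$. Then $\rho_1^+(\lambda)\in\mathcal{P}_\nu$ and $\rho_2^+(\lambda)\in\mathcal{P}_\nu$. -}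

module Defs where

open import Data.Nat using (ℕ; zero; suc; _+_; _*_; _∸_; _<_; _≤_; _>_; _≥_)
open import Data.Nat.Divisibility using (_∣_)
open import Relation.Nullary using (¬_)
open import Data.Nat.DivMod using (_/_)
open import Data.List using (List; []; _∷_; _++_; [_]; map)
open import Data.List.Relation.Unary.All using (All)
open import Data.List.Relation.Unary.Linked using (Linked)
open import Data.List.Relation.Binary.Permutation.Propositional using (_↭_)
open import Data.Product using (Σ; _×_; ∃₂)
open import Relation.Binary.PropositionalEquality using (_≡_; _≢_)

Even : ℕ → Set
Even n = 2 ∣ n

Odd : ℕ → Set
Odd n = ¬ (2 ∣ n)

-- last (smallest) part of a list; the default 0 is only used for [] which
-- is excluded from 𝒫ν
lastPart : List ℕ → ℕ
lastPart []           = 0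
lastPart (x ∷ [])     = x
lastPart (x ∷ y ∷ xs) = lastPart (y ∷ xs)

InPν : List ℕ → Set
InPν l = (l ≢ []) × Linked _>_ l × All (λ x → Odd x → x < 2 * lastPart l) l

phiE⁺ : List ℕ → List ℕ
phiE⁺ = map (2 +_)

rho2⁺ : List ℕ → List ℕ
rho2⁺ []           = []
rho2⁺ (x ∷ [])     = suc x ∷ []
rho2⁺ (x ∷ y ∷ xs) = 2 + x ∷ rho2⁺ (y ∷ xs)

data Rho1⁺ (l : List ℕ) : List ℕ → Set where
  allEven : All Even l → Rho1⁺ l (phiE⁺ l ++ [ 0 ])
  someOdd : (κ : ℕ) (rest μ : List ℕ) →
            phiE⁺ l ↭ (κ ∷ rest) →
            Odd κ →
            All (λ x → Odd x → x ≤ κ) rest →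
            μ ↭ (suc κ / 2 ∷ (κ ∸ 1) / 2 ∷ rest) →
            Linked _≥_ μ →
            Rho1⁺ l μ

module Submission where

-- Both maps are checked against a single sufficient criterion.  Call a part
-- x admissible for a bound m when x ≥ m and, if x is odd, x < 2m.  A
-- nonempty strictly decreasing list all of whose parts are admissible for
-- some m lies in 𝒫ν, because its smallest part is itself ≥ m
-- (InPν-intro).  The parts of λ ∈ 𝒫ν are admissible for its smallest part M.
--
-- ρ₂⁺(λ): shifting admissible parts by 2 makes them admissible for M+1, and
--   the new smallest part M+1 is admissible for M+1 as well.
-- ρ₁⁺(λ), case (i): all parts of φₑ⁺(λ) and the appended 0 are even, hence
--   admissible for 0.
-- ρ₁⁺(λ), case (ii): write κ = 2t+1.  Since M+2 ≤ κ < 2M+2 we get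
--   1 ≤ t ≤ M; the new parts t+1 and t are admissible for t, and every other
--   part x of φₑ⁺(λ) satisfies x ≥ M+2 > t+1 and, if odd, x < κ (κ is a
--   largest odd part and parts are distinct), so x < 2t.  Distinctness is
--   preserved, and a nonincreasing list with distinct parts is strictly
--   decreasing, so the rearrangement μ lies in 𝒫ν.

open import Defs
open import Data.Nat using (ℕ; zero; suc; _+_; _*_; _∸_; _<_; _≤_; _>_; _≥_; z≤n; s≤s)
open import Data.Nat.Properties
open import Data.Nat.Divisibility using (∣-refl; _∣0; m∣m*n; ∣m∣n⇒∣m+n)
open import Data.Nat.DivMod using (_/_; m*n/n≡m)
open import Data.List using (List; []; _∷_; _++_; [_])
open import Data.List.Properties using (++-conicalʳ)
open import Data.List.Relation.Unary.All using (All; []; _∷_)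
import Data.List.Relation.Unary.All as All
import Data.List.Relation.Unary.All.Properties as All
open import Data.List.Relation.Unary.AllPairs using (_∷_)
import Data.List.Relation.Unary.AllPairs as AllPairs
open import Data.List.Relation.Unary.Linked using (Linked; []; [-]; _∷_)
import Data.List.Relation.Unary.Linked.Properties as Linked
open import Data.List.Relation.Unary.Unique.Propositional using (Unique)
import Data.List.Relation.Unary.Unique.Propositional.Properties as Unique
open import Data.List.Relation.Binary.Permutation.Propositional using (_↭_; ↭-sym; ↭⇒↭ₛ)
open import Data.List.Relation.Binary.Permutation.Propositional.Properties using (All-resp-↭; ¬x∷xs↭[])
import Data.List.Relation.Binary.Permutation.Setoid.Properties as Permutation
open import Data.Product using (_×_; _,_; proj₁; proj₂; ∃-syntax)
open import Data.Sum using (inj₁; inj₂)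
open import Data.Empty using (⊥-elim)
open import Relation.Binary.PropositionalEquality
  using (_≡_; _≢_; refl; sym; trans; cong; cong₂; subst; setoid; ≢-sym)

odd-2+ : ∀ {n} → Odd (2 + n) → Odd n
odd-2+ odd 2∣n = odd (∣m∣n⇒∣m+n ∣-refl 2∣n)

even-2+ : ∀ {n} → Even n → Even (2 + n)
even-2+ = ∣m∣n⇒∣m+n ∣-refl

odd⇒2t+1 : ∀ n → Odd n → ∃[ t ] n ≡ suc (2 * t)
odd⇒2t+1 zero          odd = ⊥-elim (odd (2 ∣0))
odd⇒2t+1 (suc zero)    _   = 0 , refl
odd⇒2t+1 (suc (suc n)) odd with odd⇒2t+1 n (odd-2+ odd)
... | t , refl = suc t , cong suc (sym (*-suc 2 t))

-- An odd number below 2t+1 is below 2t, since 2t is even.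
odd<2t+1⇒<2t : ∀ {n} t → Odd n → n < suc (2 * t) → n < 2 * t
odd<2t+1⇒<2t t odd n<2t+1 = ≤∧≢⇒< (≤-pred n<2t+1) λ { refl → odd (m∣m*n t) }

half-double : ∀ n → 2 * n / 2 ≡ n
half-double n = trans (cong (_/ 2) (*-comm 2 n)) (m*n/n≡m n 2)

half-double+2 : ∀ n → suc (suc (2 * n)) / 2 ≡ suc n
half-double+2 n = trans (cong (_/ 2) (sym (*-suc 2 n))) (half-double (suc n))

n<2n : ∀ {n} → 1 ≤ n → n < 2 * n
n<2n {n} 1≤n = m<m+n n (≤-trans 1≤n (≤-reflexive (sym (+-identityʳ n))))

1+n<2n : ∀ {n} → 2 ≤ n → suc n < 2 * n
1+n<2n {n} 2≤n = begin-strict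
  suc n     ≡⟨ +-comm 1 n ⟩
  n + 1     <⟨ +-monoʳ-< n (≤-trans 2≤n (≤-reflexive (sym (+-identityʳ n)))) ⟩
  n + (n + 0) ∎
  where open ≤-Reasoning

decreasing⇒unique : ∀ {xs} → Linked _>_ xs → Unique xs
decreasing⇒unique dec =
  AllPairs.map (λ x>y x≡y → <-irrefl (sym x≡y) x>y)
    (Linked.Linked⇒AllPairs (λ y<x z<y → <-trans z<y y<x) dec)

unique-resp-↭ : ∀ {xs ys} → xs ↭ ys → Unique xs → Unique ys
unique-resp-↭ xs↭ys = Permutation.Unique-resp-↭ (setoid ℕ) (↭⇒↭ₛ xs↭ys)

nonincreasing⇒decreasing : ∀ {xs} → Linked _≥_ xs → Unique xs → Linked _>_ xs
nonincreasing⇒decreasing []            _                   = []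
nonincreasing⇒decreasing [-]           _                   = [-]
nonincreasing⇒decreasing (x≥y ∷ x≥ys) ((x≢y ∷ _) ∷ unique) =
  ≤∧≢⇒< x≥y (≢-sym x≢y) ∷ nonincreasing⇒decreasing x≥ys unique

↭-nonempty : ∀ {xs : List ℕ} {y ys} → xs ↭ y ∷ ys → xs ≢ []
↭-nonempty xs↭y∷ys refl = ¬x∷xs↭[] (↭-sym xs↭y∷ys)

lastPart-All : ∀ {P : ℕ → Set} xs → xs ≢ [] → All P xs → P (lastPart xs)
lastPart-All []           nonempty _          = ⊥-elim (nonempty refl)
lastPart-All (x ∷ [])     _        (px ∷ _)   = px
lastPart-All (x ∷ y ∷ xs) _        (_ ∷ pxs) = lastPart-All (y ∷ xs) (λ ()) pxs

lastPart-≤ : ∀ xs → Linked _>_ xs → All (lastPart xs ≤_) xs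
lastPart-≤ []           _           = []
lastPart-≤ (x ∷ [])     _           = ≤-refl ∷ []
lastPart-≤ (x ∷ y ∷ xs) (x>y ∷ dec) with lastPart-≤ (y ∷ xs) dec
... | last≤y ∷ last≤ys = <⇒≤ (≤-<-trans last≤y x>y) ∷ last≤y ∷ last≤ys

Admissible : ℕ → ℕ → Set
Admissible m x = m ≤ x × (Odd x → x < 2 * m)

-- Membership criterion: the smallest part is ≥ m, so 2m bounds 2·(last part).
InPν-intro : ∀ m {xs} → xs ≢ [] → Linked _>_ xs → All (Admissible m) xs → InPν xs
InPν-intro m {xs} nonempty dec admissible =
  nonempty , dec ,
  All.map (λ (_ , odd<2m) odd → <-≤-trans (odd<2m odd) (*-monoʳ-≤ 2 m≤last)) admissible
  where
  m≤last : m ≤ lastPart xs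
  m≤last = proj₁ (lastPart-All xs nonempty admissible)

InPν⇒admissible : ∀ {xs} → InPν xs → All (Admissible (lastPart xs)) xs
InPν⇒admissible {xs} (_ , dec , oddBound) = All.zip (lastPart-≤ xs dec , oddBound)

2+-admissible : ∀ {m x} → Admissible m x → Admissible (suc m) (2 + x)
2+-admissible {m} (m≤x , odd<2m) =
  s≤s (m≤n⇒m≤1+n m≤x) ,
  λ odd → <-≤-trans (s≤s (s≤s (odd<2m (odd-2+ odd)))) (≤-reflexive (sym (*-suc 2 m)))

even-admissible : ∀ {x} → Even x → Admissible 0 x
even-admissible even = z≤n , λ odd → ⊥-elim (odd even)

-- ρ₂⁺ keeps a list nonempty, and strictly decreasing: the last part only
-- grows by 1 while the others grow by 2.
rho2⁺-nonempty : ∀ xs → xs ≢ [] → rho2⁺ xs ≢ []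
rho2⁺-nonempty []          nonempty = nonempty
rho2⁺-nonempty (_ ∷ [])    _        = λ ()
rho2⁺-nonempty (_ ∷ _ ∷ _) _        = λ ()

rho2⁺-decreasing : ∀ xs → Linked _>_ xs → Linked _>_ (rho2⁺ xs)
rho2⁺-decreasing []               _           = []
rho2⁺-decreasing (x ∷ [])         _           = [-]
rho2⁺-decreasing (x ∷ y ∷ [])     (x>y ∷ _)   = s≤s (s≤s (<⇒≤ x>y)) ∷ [-]
rho2⁺-decreasing (x ∷ y ∷ z ∷ xs) (x>y ∷ dec) = s≤s (s≤s x>y) ∷ rho2⁺-decreasing (y ∷ z ∷ xs) dec

rho2⁺-admissible : ∀ xs → All (Admissible (lastPart xs)) xs →
                   All (Admissible (suc (lastPart xs))) (rho2⁺ xs)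
rho2⁺-admissible []           _            = []
rho2⁺-admissible (x ∷ [])     _            = (≤-refl , λ _ → n<2n (s≤s z≤n)) ∷ []
rho2⁺-admissible (x ∷ y ∷ xs) (adm ∷ adms) = 2+-admissible adm ∷ rho2⁺-admissible (y ∷ xs) adms

rho2⁺-InPν : ∀ {l} → InPν l → InPν (rho2⁺ l)
rho2⁺-InPν {l} ip@(nonempty , dec , _) =
  InPν-intro (suc (lastPart l)) (rho2⁺-nonempty l nonempty) (rho2⁺-decreasing l dec)
    (rho2⁺-admissible l (InPν⇒admissible ip))

-- φₑ⁺ followed by a part 0 is strictly decreasing, all shifted parts being ≥ 2.
phiE⁺-append0-decreasing : ∀ xs → Linked _>_ xs → Linked _>_ (phiE⁺ xs ++ [ 0 ])
phiE⁺-append0-decreasing []           _           = [-]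
phiE⁺-append0-decreasing (x ∷ [])     _           = s≤s z≤n ∷ [-]
phiE⁺-append0-decreasing (x ∷ y ∷ xs) (x>y ∷ dec) =
  s≤s (s≤s x>y) ∷ phiE⁺-append0-decreasing (y ∷ xs) dec

rho1⁺-allEven : ∀ {l} → InPν l → All Even l → InPν (phiE⁺ l ++ [ 0 ])
rho1⁺-allEven {l} (_ , dec , _) evens =
  InPν-intro 0 (λ eq → [0]≢[] (++-conicalʳ (phiE⁺ l) [ 0 ] eq))
    (phiE⁺-append0-decreasing l dec)
    (All.map even-admissible (All.++⁺ (All.map⁺ (All.map even-2+ evens)) (2 ∣0 ∷ [])))
  where
  [0]≢[] : [ 0 ] ≢ []
  [0]≢[] ()

phiE⁺-parts : ∀ {m xs} → All (Admissible m) xs →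
              All (λ y → 2 + m ≤ y × Admissible (suc m) y) (phiE⁺ xs)
phiE⁺-parts adms = All.map⁺ (All.map (λ adm → s≤s (s≤s (proj₁ adm)) , 2+-admissible adm) adms)

phiE⁺-unique : ∀ {xs} → Linked _>_ xs → Unique (phiE⁺ xs)
phiE⁺-unique dec = Unique.map⁺ (+-cancelˡ-≡ 2 _ _) (decreasing⇒unique dec)

half-bounds : ∀ {m t} → 2 + m ≤ suc (2 * t) → suc (2 * t) < 2 * suc m → 1 ≤ t × t ≤ m
half-bounds {m} {zero}  (s≤s ())  _
half-bounds {m} {suc t} _         κ<2m+2 =
  s≤s z≤n , ≤-pred (*-cancelˡ-≤ 2 (subst (_≤ 2 * suc m) (sym (*-suc 2 (suc t))) κ<2m+2))

successor-admissible : ∀ {t} → 1 ≤ t → Admissible t (suc t)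
successor-admissible {t} 1≤t = n≤1+n t , odd⇒bound
  where
  odd⇒bound : Odd (suc t) → suc t < 2 * t
  odd⇒bound odd with m≤n⇒m<n∨m≡n 1≤t
  ... | inj₁ 2≤t = 1+n<2n 2≤t
  ... | inj₂ refl = ⊥-elim (odd ∣-refl)

self-admissible : ∀ {t} → 1 ≤ t → Admissible t t
self-admissible 1≤t = ≤-refl , λ _ → n<2n 1≤t

remaining-part : ∀ {m t x} → t ≤ m → 2 + m ≤ x → (Odd x → x ≤ suc (2 * t)) →
                 suc (2 * t) ≢ x → suc t < x × Admissible t x
remaining-part {t = t} {x} t≤m m+2≤x odd⇒≤κ κ≢x =
  t+1<x , ≤-trans (n≤1+n t) (<⇒≤ t+1<x) ,
  λ odd → odd<2t+1⇒<2t t odd (≤∧≢⇒< (odd⇒≤κ odd) (≢-sym κ≢x))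
  where
  t+1<x : suc t < x
  t+1<x = ≤-trans (s≤s (s≤s t≤m)) m+2≤x

unique-prepend : ∀ {t xs} → All (suc t <_) xs → Unique xs → Unique (suc t ∷ t ∷ xs)
unique-prepend {t} above unique =
  (1+n≢n ∷ All.map <⇒≢ above) ∷ All.map (λ t+1<x → <⇒≢ (<-trans (n<1+n t) t+1<x)) above ∷ unique

rho1⁺-someOdd : ∀ {l κ rest μ} → InPν l → phiE⁺ l ↭ κ ∷ rest → Odd κ →
                All (λ x → Odd x → x ≤ κ) rest →
                μ ↭ suc κ / 2 ∷ (κ ∸ 1) / 2 ∷ rest → Linked _≥_ μ → InPν μ
rho1⁺-someOdd {l} {κ} {rest} {μ} ip@(_ , dec , _) φ↭κ∷rest oddκ κ-largest μ↭new μ-nonincreasing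
  with odd⇒2t+1 κ oddκ
... | t , refl =
  InPν-intro t (↭-nonempty μ↭new)
    (nonincreasing⇒decreasing μ-nonincreasing (unique-resp-↭ (↭-sym μ↭halves) unique-halves))
    (All-resp-↭ (↭-sym μ↭halves) admissible-halves)
  where
  μ↭halves : μ ↭ suc t ∷ t ∷ rest
  μ↭halves = subst (μ ↭_) (cong₂ (λ a b → a ∷ b ∷ rest) (half-double+2 t) (half-double t)) μ↭new
  parts : All (λ y → 2 + lastPart l ≤ y × Admissible (suc (lastPart l)) y) (κ ∷ rest)
  parts = All-resp-↭ φ↭κ∷rest (phiE⁺-parts (InPν⇒admissible ip))
  unique-κ∷rest : Unique (κ ∷ rest)
  unique-κ∷rest = unique-resp-↭ φ↭κ∷rest (phiE⁺-unique dec)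
  bounds : 1 ≤ t × t ≤ lastPart l
  bounds = let (m+2≤κ , _ , κ<2m+2) = All.head parts in half-bounds m+2≤κ (κ<2m+2 oddκ)
  remaining : All (λ x → suc t < x × Admissible t x) rest
  remaining = All.zipWith (λ ((m+2≤x , _) , odd⇒≤κ , κ≢x) → remaining-part (proj₂ bounds) m+2≤x odd⇒≤κ κ≢x)
                (All.tail parts , All.zip (κ-largest , AllPairs.head unique-κ∷rest))
  unique-halves : Unique (suc t ∷ t ∷ rest)
  unique-halves = unique-prepend (All.map proj₁ remaining) (AllPairs.tail unique-κ∷rest)
  admissible-halves : All (Admissible t) (suc t ∷ t ∷ rest)
  admissible-halves =
    successor-admissible (proj₁ bounds) ∷ self-admissible (proj₁ bounds) ∷ All.map proj₂ remaining

rho1⁺-InPν : ∀ {l μ} → InPν l → Rho1⁺ l μ → InPν μ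
rho1⁺-InPν ip (allEven evens) = rho1⁺-allEven ip evens
rho1⁺-InPν ip (someOdd _ _ _ φ↭κ∷rest oddκ κ-largest μ↭new μ-nonincreasing) =
  rho1⁺-someOdd ip φ↭κ∷rest oddκ κ-largest μ↭new μ-nonincreasing

lemma4 : (l : List ℕ) → InPν l →
         ((μ : List ℕ) → Rho1⁺ l μ → InPν μ) × InPν (rho2⁺ l)
lemma4 l ip = (λ μ → rho1⁺-InPν ip) , rho2⁺-InPν ip
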